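{- For propositional variables $p,q$, the formula $(p\land(p\to_{\mathtt{c}}q))\to_{\mathtt{i}} q$ is not a theorem of the Hilbert system $(\mathbf{C+J})^{ - }$.
   Context: Formulas are built from a countably infinite set $\mathsf{Prop}$ of propositional variables by $A ::= p \mid \bot \mid A \lor A \mid A \land A \mid A \to_{\mathtt{i}} A \mid A \to_{\mathtt{c}} A$; $\mathsf{Form}_{\mathbf{C}}$ is the set of formulas not containing $\to_{\mathtt{i}}$. Persistent formulas are given by $E ::= \bot \mid p \mid A \to_{\mathtt{i}} A \mid E \land E \mid E \lor E$ ($p\in\mathsf{Prop}$, $A$ arbitrary formula). The Hilbert system $(\mathbf{C+J})^{ - }$ has axioms: (CL) all substitution instances (uniformly replacing propositional variables by arbitrary formulas) of classical tautologies in $\mathsf{Form}_{\mathbf{C}}$ (two-valued, $\bot$ false, $\to_{\mathtt{c}}$ material implication); (CK) $(A \to_{\mathtt{i}} (B \to_{\mathtt{c}} C)) \to_{\mathtt{c}} ((A \to_{\mathtt{i}} B) \to_{\mathtt{c}} (A \to_{\mathtt{i}} C))$; (ID) $A \to_{\mathtt{i}} A$; (CMP) $(A \to_{\mathtt{i}} B) \to_{\mathtt{c}} (A \to_{\mathtt{c}} B)$; (PER) $A \to_{\mathtt{c}} (B \to_{\mathtt{i}} A)$ for persistent $A$; and exactly two rules: (MPI) from $A$ and $A \to_{\mathtt{i}} B$ infer $B$; (RCN) from $A$ infer $B \to_{\mathtt{i}} A$. (In particular, classical modus ponens for $\to_{\mathtt{c}}$ is not a rule.) Theorems are formulas derivable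 from the axioms by the rules. -}

module Defs where

open import Data.Nat using (ℕ)
open import Data.Bool using (Bool; true; false; _∧_; _∨_; not)
open import Data.Product using (Σ; _×_)
open import Relation.Binary.PropositionalEquality using (_≡_)

data Form : Set where
  var  : ℕ → Form
  ⊥'   : Form
  _∨'_ : Form → Form → Form
  _∧'_ : Form → Form → Form
  _→i_ : Form → Form → Form
  _→c_ : Form → Form → Form

infixr 6 _∧'_
infixr 5 _∨'_
infixr 4 _→i_ _→c_

data IsClassical : Form → Set where
  cvar : ∀ n → IsClassical (var n)
  c⊥   : IsClassical ⊥'
  c∨   : ∀ {A B} → IsClassical A → IsClassical B → IsClassical (A ∨' B)
  c∧   : ∀ {A B} → IsClassical A → IsClassical B → IsClassical (A ∧' B)
  c→   : ∀ {A B} → IsClassical A → IsClassical B → IsClassical (A →c B)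

-- two-valued evaluation (→i is never evaluated for classical formulas;
-- it is given the material reading only to make the function total)
eval : (ℕ → Bool) → Form → Bool
eval v (var n)  = v n
eval v ⊥'       = false
eval v (A ∨' B) = eval v A ∨ eval v B
eval v (A ∧' B) = eval v A ∧ eval v B
eval v (A →i B) = not (eval v A) ∨ eval v B
eval v (A →c B) = not (eval v A) ∨ eval v B

Tautology : Form → Set
Tautology A = IsClassical A × (∀ (v : ℕ → Bool) → eval v A ≡ true)

subst : (ℕ → Form) → Form → Form
subst σ (var n)  = σ n
subst σ ⊥'       = ⊥'
subst σ (A ∨' B) = subst σ A ∨' subst σ B
subst σ (A ∧' B) = subst σ A ∧' subst σ B
subst σ (A →i B) = subst σ A →i subst σ B
subst σ (A →c B) = subst σ A →c subst σ B

data Persistent : Form → Set where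
  p⊥   : Persistent ⊥'
  pvar : ∀ n → Persistent (var n)
  p→i  : ∀ A B → Persistent (A →i B)
  p∧   : ∀ {E F} → Persistent E → Persistent F → Persistent (E ∧' F)
  p∨   : ∀ {E F} → Persistent E → Persistent F → Persistent (E ∨' F)

data ⊢_ : Form → Set where
  CL  : ∀ (T : Form) (σ : ℕ → Form) → Tautology T → ⊢ subst σ T
  CK  : ∀ A B C → ⊢ ((A →i (B →c C)) →c ((A →i B) →c (A →i C)))
  ID  : ∀ A → ⊢ (A →i A)
  CMP : ∀ A B → ⊢ ((A →i B) →c (A →c B))
  PER : ∀ A B → Persistent A → ⊢ (A →c (B →i A))
  MPI : ∀ {A B} → ⊢ A → ⊢ (A →i B) → ⊢ B
  RCN : ∀ {A} B → ⊢ A → ⊢ (B →i A)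

infix 2 ⊢_

{-# OPTIONS --safe #-}
-- Read →i as material implication and →c as the constant true. Every axiom
-- is then valid: a tautology of Form_C is built from ∧ and ∨, which are
-- monotone, over variables and →c-subformulas, which become true, so its
-- substitution instances stay true; CK, CMP and PER are →c-formulas; and MPI
-- and RCN preserve validity. But under p ↦ true, q ↦ false the formula
-- (p ∧ (p →c q)) →i q is false.
module Submission where

open import Defs
open import Data.Nat using (ℕ; _≟_)
open import Data.Bool using (Bool; true; false; _∧_; _∨_; not)
open import Data.Bool.Properties using (∨-zeroʳ; ∨-inverseˡ)
open import Data.Product using (_,_)
open import Function using (_∘_)
open import Relation.Nullary using (¬_; does)
open import Relation.Nullary.Decidable using (dec-true; dec-false)
open import Relation.Binary.PropositionalEquality using (_≡_; _≢_; refl; sym)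

⟦_⟧ : Form → (ℕ → Bool) → Bool
⟦ var n ⟧  v = v n
⟦ ⊥' ⟧     v = false
⟦ A ∨' B ⟧ v = ⟦ A ⟧ v ∨ ⟦ B ⟧ v
⟦ A ∧' B ⟧ v = ⟦ A ⟧ v ∧ ⟦ B ⟧ v
⟦ A →i B ⟧ v = not (⟦ A ⟧ v) ∨ ⟦ B ⟧ v
⟦ A →c B ⟧ v = true

∨-preserves-true : ∀ {a b c d} → (a ≡ true → c ≡ true) → (b ≡ true → d ≡ true) →
                   a ∨ b ≡ true → c ∨ d ≡ true
∨-preserves-true {true}          a⇒c _   _ rewrite a⇒c refl = refl
∨-preserves-true {false} {true} {c} _ b⇒d _ rewrite b⇒d refl = ∨-zeroʳ c

∧-preserves-true : ∀ {a b c d} → (a ≡ true → c ≡ true) → (b ≡ true → d ≡ true) →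
                   a ∧ b ≡ true → c ∧ d ≡ true
∧-preserves-true {true} {true} a⇒c b⇒d _ rewrite a⇒c refl | b⇒d refl = refl

material-mp : ∀ {a b} → a ≡ true → not a ∨ b ≡ true → b ≡ true
material-mp {true} refl a⇒b = a⇒b

eval⇒⟦subst⟧ : ∀ {T} (σ : ℕ → Form) (v : ℕ → Bool) → IsClassical T →
               eval (λ n → ⟦ σ n ⟧ v) T ≡ true → ⟦ subst σ T ⟧ v ≡ true
eval⇒⟦subst⟧ σ v (cvar n)  holds = holds
eval⇒⟦subst⟧ σ v c⊥        ()
eval⇒⟦subst⟧ σ v (c∨ A B)  holds =
  ∨-preserves-true (eval⇒⟦subst⟧ σ v A) (eval⇒⟦subst⟧ σ v B) holds
eval⇒⟦subst⟧ σ v (c∧ A B)  holds =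
  ∧-preserves-true (eval⇒⟦subst⟧ σ v A) (eval⇒⟦subst⟧ σ v B) holds
eval⇒⟦subst⟧ σ v (c→ _ _)  _     = refl

sound : ∀ {A} → ⊢ A → (v : ℕ → Bool) → ⟦ A ⟧ v ≡ true
sound (CL T σ (classical , taut)) v = eval⇒⟦subst⟧ σ v classical (taut _)
sound (CK _ _ _)                  v = refl
sound (ID A)                      v = ∨-inverseˡ (⟦ A ⟧ v)
sound (CMP _ _)                   v = refl
sound (PER _ _ _)                 v = refl
sound (MPI ⊢A ⊢A→B)               v = material-mp (sound ⊢A v) (sound ⊢A→B v)
sound (RCN B ⊢A)                  v rewrite sound ⊢A v = ∨-zeroʳ (not (⟦ B ⟧ v))

theorem14 : (p q : ℕ) → p ≢ q → ¬ (⊢ ((var p ∧' (var p →c var q)) →i var q))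
theorem14 p q p≢q ⊢φ = false≢true (sound ⊢φ only-p)
  where
  only-p : ℕ → Bool
  only-p n = does (n ≟ p)

  false≢true : not (only-p p ∧ true) ∨ only-p q ≢ true
  false≢true rewrite dec-true (p ≟ p) refl | dec-false (q ≟ p) (p≢q ∘ sym) = λ ()
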